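{- Let $p$ be an odd prime with $p-1$ not divisible by $4$. Let $G=\{a\in\mathbb{F}_{p^4}: a^{p^2}+a=0\}$ (an additive group of order $p^2$), let $G_1,\dots,G_{p+1}$ be its $p+1$ subgroups of order $p$ (the additive subgroups $\{0,a,2a,\dots,(p-1)a\}$ generated by non-zero $a\in G$), and let $\phi_1:\mathbb{F}_{p^4}\to\mathbb{F}_{p^4}$, $a\mapsto a^p$. Then no subgroup $G_i$ is stable under $\phi_1$. Moreover, the set of the $p+1$ subgroups $G_i$ is the union of $\frac{p+1}{2}$ subsets consisting of two distinct elements $\{G_i,G_j\}$ such that $\phi_1(G_i)=G_j$ and $\phi_1(G_j)=G_i$. -}

module Defs where

open import Level using (0ℓ)
open import Data.Nat using (ℕ; zero; suc; _^_)
open import Data.Fin using (Fin)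
open import Data.Product using (Σ; ∃; _×_; _,_)
open import Function.Bundles using (_↔_)
open import Relation.Nullary using (¬_)
open import Relation.Binary.PropositionalEquality using (_≡_)
open import Algebra.Structures using (IsCommutativeRing)

record Field : Set₁ where
  field
    Carrier : Set
    _+_ _*_ : Carrier → Carrier → Carrier
    -_      : Carrier → Carrier
    0# 1#   : Carrier
    isCommutativeRing : IsCommutativeRing _≡_ _+_ _*_ -_ 0# 1#
    0≢1     : ¬ (0# ≡ 1#)
    inverse : ∀ x → ¬ (x ≡ 0#) → ∃ λ y → x * y ≡ 1#

  infixl 6 _+_
  infixl 7 _*_

  _^'_ : Carrier → ℕ → Carrier
  x ^' zero  = 1#
  x ^' suc n = x * (x ^' n)

  _·'_ : ℕ → Carrier → Carrier
  zero  ·' x = 0#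
  suc k ·' x = x + (k ·' x)

record FiniteField (q : ℕ) : Set₁ where
  field
    field' : Field
  open Field field' public
  field
    card : Carrier ↔ Fin q

Subset : Set → Set₁
Subset A = A → Set

_≐_ : {A : Set} → Subset A → Subset A → Set
S ≐ T = ∀ x → (S x → T x) × (T x → S x)

image : {A : Set} → (A → A) → Subset A → Subset A
image f S y = ∃ λ x → S x × (f x ≡ y)

module FieldDefs {q : ℕ} (K : FiniteField q) (p : ℕ) where
  open FiniteField K public

  G : Subset Carrier
  G a = (a ^' (p ^ 2)) + a ≡ 0#

  ⟨_⟩ : Carrier → Subset Carrier
  ⟨ a ⟩ x = ∃ λ k → x ≡ k ·' a

  φ₁ : Carrier → Carrier
  φ₁ a = a ^' p

  -- "a generates one of the subgroups G_i of order p of G"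
  Gen : Carrier → Set
  Gen a = G a × ¬ (a ≡ 0#)

-- Write p = 3 + 4J and h = (p - 1) / 2 = 1 + 2J, which is odd.  A field with p⁴ elements has
-- characteristic p, so φ₁ = (_^ p) is additive and φ₁⁴ = id; the prime field 𝔽ₚ is the fixed field
-- of φ₁, and -1 is not a square in 𝔽ₚ because (-1)ʰ = -1.  G is the set where φ₁² = -1.  If a
-- non-zero c ∈ G had φ₁ c = μ c with μ ∈ 𝔽ₚ, then -c = φ₁² c = μ² c and μ² = -1; so no line of G
-- is φ₁-stable.  In particular any non-zero a ∈ G (for instance x^(p²) - x) and b = φ₁ a are
-- 𝔽ₚ-independent, and counting roots of X^(p²) + X gives G = 𝔽ₚ a ⊕ 𝔽ₚ b.  Every ν ∈ 𝔽ₚ is either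
-- a square j² or satisfies ν j² = -1 for some 0 ≤ j ≤ h; accordingly the line of a + ν b is the
-- line of u j = a + j² b or of v j = φ₁ (u j) = b - j² a, and b itself is v 0.  So the p + 1 lines
-- of G fall into the h + 1 pairs {⟨u j⟩, ⟨v j⟩}, which φ₁ swaps because φ₁² = -1.
{-# OPTIONS --safe #-}
module Submission where

open import Algebra.Bundles using (CommutativeRing; CommutativeMonoid)
import Algebra.Properties.CommutativeSemiring.Binomial
import Algebra.Solver.Ring.NaturalCoefficients
open import Data.Fin as Fin using (Fin; toℕ)
open import Data.Fin.Patterns using (0F)
import Data.Fin.Properties as Fin
open import Data.Maybe using (nothing)
open import Data.Nat as ℕ using (ℕ; zero; suc; nonTrivial⇒n>1; _∸_; _^_; _/_; _%_; _≤_; _<_; z≤n; s≤s)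
open import Data.Nat.Combinatorics using (_C_; nC1≡n; nCn≡1; nCk+nC[k+1]≡[n+1]C[k+1]; k>n⇒nCk≡0)
open import Data.Nat.Coprimality using (prime⇒coprime; coprime-Bézout)
open import Data.Nat.Divisibility using (_∣_; divides; ∣⇒≤; ∣m∣n⇒∣m+n)
open import Data.Nat.DivMod using ([m+kn]%n≡m%n; m*n/n≡m)
open import Data.Nat.GCD using (module Bézout)
open import Data.Nat.Primality using (Prime; euclidsLemma; prime⇒nonTrivial)
import Data.Nat.Properties as ℕ
open import Data.Nat.Solver using (module +-*-Solver)
open import Data.Product using (Σ; ∃; _×_; _,_; proj₁; proj₂; uncurry)
open import Data.Sum using (_⊎_; inj₁; inj₂)
open import Data.Vec using (Vec; []; _∷_; replicate)
open import Data.Vec.Functional using (removeAt) renaming (_∷_ to _∷ᶠ_)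
open import Function using (_∘′_; id)
open import Function.Bundles using (_↔_; mk↔ₛ′; Inverse; Injection)
open import Function.Construct.Composition using (_↔-∘_)
open import Function.Construct.Symmetry using (↔-sym)
open import Function.Definitions using (Injective)
open import Function.Properties.Inverse using (↔⇒↣)
open import Level using (0ℓ)
open import Relation.Binary.Definitions using (DecidableEquality; tri<; tri≈; tri>)
open import Relation.Binary.PropositionalEquality
open import Relation.Nullary using (¬_; Dec; contradiction; yes; no)
open import Relation.Nullary.Decidable using (via-injection)

open import Defs

[1+k]*[1+n]C[1+k]≡[1+n]*nCk : ∀ n k → suc k ℕ.* (suc n C suc k) ≡ suc n ℕ.* (n C k)
[1+k]*[1+n]C[1+k]≡[1+n]*nCk n       zero    =
  trans (ℕ.+-identityʳ _) (trans (nC1≡n (suc n)) (sym (ℕ.*-identityʳ (suc n))))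
[1+k]*[1+n]C[1+k]≡[1+n]*nCk zero    (suc k) = begin
  suc (suc k) ℕ.* (1 C suc (suc k)) ≡⟨ cong (suc (suc k) ℕ.*_) (k>n⇒nCk≡0 {1} {suc (suc k)} (s≤s (s≤s z≤n))) ⟩
  suc (suc k) ℕ.* 0                 ≡⟨ ℕ.*-zeroʳ (suc (suc k)) ⟩
  0                                 ≡⟨ cong (1 ℕ.*_) (k>n⇒nCk≡0 {0} {suc k} (s≤s z≤n)) ⟨
  1 ℕ.* (0 C suc k)                 ∎
  where open ≡-Reasoning
[1+k]*[1+n]C[1+k]≡[1+n]*nCk (suc n) (suc k) = begin
  suc (suc k) ℕ.* (suc (suc n) C suc (suc k))
    ≡⟨ cong (suc (suc k) ℕ.*_) (nCk+nC[k+1]≡[n+1]C[k+1] (suc n) (suc k)) ⟨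
  suc (suc k) ℕ.* (c₁ ℕ.+ c₂)
    ≡⟨ regroup k c₁ c₂ ⟩
  c₁ ℕ.+ (suc k ℕ.* c₁ ℕ.+ suc (suc k) ℕ.* c₂)
    ≡⟨ cong₂ (λ s t → c₁ ℕ.+ (s ℕ.+ t)) ([1+k]*[1+n]C[1+k]≡[1+n]*nCk n k) ([1+k]*[1+n]C[1+k]≡[1+n]*nCk n (suc k)) ⟩
  c₁ ℕ.+ (suc n ℕ.* (n C k) ℕ.+ suc n ℕ.* (n C suc k))
    ≡⟨ cong (c₁ ℕ.+_) (ℕ.*-distribˡ-+ (suc n) (n C k) (n C suc k)) ⟨
  c₁ ℕ.+ suc n ℕ.* (n C k ℕ.+ n C suc k)
    ≡⟨ cong (λ c → c₁ ℕ.+ suc n ℕ.* c) (nCk+nC[k+1]≡[n+1]C[k+1] n k) ⟩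
  suc (suc n) ℕ.* c₁
    ∎
  where
  open ≡-Reasoning
  c₁ = suc n C suc k
  c₂ = suc n C suc (suc k)
  regroup : ∀ k a b → suc (suc k) ℕ.* (a ℕ.+ b) ≡ a ℕ.+ (suc k ℕ.* a ℕ.+ suc (suc k) ℕ.* b)
  regroup = solve 3 (λ k a b → (con 2 :+ k) :* (a :+ b) := a :+ ((con 1 :+ k) :* a :+ (con 2 :+ k) :* b)) refl
    where open +-*-Solver

prime∣pCk : ∀ {p k} → Prime p → 0 < k → k < p → p ∣ p C k
prime∣pCk {suc n} {suc k} p-prime _ k<p
  with euclidsLemma (suc k) (suc n C suc k) p-prime
         (divides (n C k) (trans ([1+k]*[1+n]C[1+k]≡[1+n]*nCk n k) (ℕ.*-comm (suc n) (n C k))))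
... | inj₁ p∣k = contradiction (∣⇒≤ p∣k) (ℕ.<⇒≱ k<p)
... | inj₂ p∣C = p∣C

odd∧4∤p∸1⇒p≡3+4J : ∀ p → p % 2 ≡ 1 → ¬ 4 ∣ p ∸ 1 → ∃ λ J → p ≡ 3 ℕ.+ 4 ℕ.* J
odd∧4∤p∸1⇒p≡3+4J 0 () _
odd∧4∤p∸1⇒p≡3+4J 1 _ 4∤0 = contradiction (divides 0 refl) 4∤0
odd∧4∤p∸1⇒p≡3+4J 2 () _
odd∧4∤p∸1⇒p≡3+4J 3 _ _   = 0 , refl
odd∧4∤p∸1⇒p≡3+4J 4 () _
odd∧4∤p∸1⇒p≡3+4J (suc (suc (suc (suc (suc m))))) odd 4∤p∸1 =
  shift (odd∧4∤p∸1⇒p≡3+4J (suc m) odd′ (4∤p∸1 ∘′ ∣m∣n⇒∣m+n (divides 1 refl)))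
  where
  odd′ : suc m % 2 ≡ 1
  odd′ = trans (sym ([m+kn]%n≡m%n (suc m) 2 2)) (trans (cong (_% 2) (ℕ.+-comm (suc m) 4)) odd)
  shift : (∃ λ J → suc m ≡ 3 ℕ.+ 4 ℕ.* J) → ∃ λ J → 4 ℕ.+ suc m ≡ 3 ℕ.+ 4 ℕ.* J
  shift (J , refl) = suc J , sym (cong (3 ℕ.+_) (ℕ.*-suc 4 J))

≐-trans : {A : Set} {S T U : Subset A} → S ≐ T → T ≐ U → S ≐ U
≐-trans S≐T T≐U x = proj₁ (T≐U x) ∘′ proj₁ (S≐T x) , proj₂ (S≐T x) ∘′ proj₂ (T≐U x)

module FieldProperties (F : Field) where
  open Field F

  ring : CommutativeRing 0ℓ 0ℓ
  ring = record { isCommutativeRing = isCommutativeRing }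

  open CommutativeRing ring public
    using (_-_; +-comm; +-identityˡ; +-identityʳ; -‿inverseˡ; -‿inverseʳ;
           *-assoc; *-comm; *-identityˡ; *-identityʳ; distribˡ; distribʳ; zeroˡ; zeroʳ)
  open import Algebra.Properties.Ring (CommutativeRing.ring ring) public
    using (-‿involutive; -‿distribˡ-*; -‿distribʳ-*; -1*x≈-x; [y-z]x≈yx-zx)
  open import Algebra.Properties.AbelianGroup (CommutativeRing.+-abelianGroup ring) public
    using ()
    renaming ( x∙y⁻¹≈ε⇒x≈y to x-y≡0⇒x≡y; inverseˡ-unique to x+y≡0⇒x≡-y
             ; identityʳ-unique to x+y≡x⇒y≡0; //-rightDividesˡ to x-y+y≡x; //-rightDividesʳ to x+y-y≡x
             ; ⁻¹-anti-homo‿- to -[x-y]≡y-x; ε⁻¹≈ε to -0#≡0#; ⁻¹-∙-comm to -x+-y≡-[x+y]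
             ; x≈y⇒x∙y⁻¹≈ε to x≡y⇒x-y≡0)
  open import Algebra.Properties.Semiring.Mult (CommutativeRing.semiring ring)
    using (×-homo-+; ×1-homo-*) renaming (_×_ to _×ᴿ_)
  open import Algebra.Properties.Semiring.Exp (CommutativeRing.semiring ring)
    using (^-assocʳ) renaming (_^_ to _^ᴿ_)
  open import Algebra.Properties.CommutativeSemiring.Exp (CommutativeRing.commutativeSemiring ring)
    using (^-distrib-*)
  open import Algebra.Properties.Monoid.Sum (CommutativeRing.+-monoid ring)
    using (sum-cong-≗; sum-replicate-zero; sum-init-last; sum-syntax)
  open import Algebra.Properties.CommutativeMonoid.Sum (CommutativeRing.*-commutativeMonoid ring) public
    using () renaming (sum to ∏; sum-remove to ∏-remove; sum-replicate to ∏-replicate; sum-cong-≗ to ∏-cong-≗)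
  module Binomial = Algebra.Properties.CommutativeSemiring.Binomial (CommutativeRing.commutativeSemiring ring)
  module RingSolver = Algebra.Solver.Ring.NaturalCoefficients
    (CommutativeRing.commutativeSemiring ring) (λ _ _ → nothing)
  open ≡-Reasoning

  1≢0 : 1# ≢ 0#
  1≢0 = 0≢1 ∘′ sym

  -1≢0 : - 1# ≢ 0#
  -1≢0 -1≡0 = 1≢0 (trans (sym (-‿involutive 1#)) (trans (cong -_ -1≡0) -0#≡0#))

  *-cancelˡ : ∀ {x y z} → x ≢ 0# → x * y ≡ x * z → y ≡ z
  *-cancelˡ {x} {y} {z} x≢0 xy≡xz = begin
    y             ≡⟨ *-identityˡ y ⟨
    1# * y        ≡⟨ cong (_* y) x⁻¹x≡1 ⟨
    x⁻¹ * x * y   ≡⟨ *-assoc x⁻¹ x y ⟩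
    x⁻¹ * (x * y) ≡⟨ cong (x⁻¹ *_) xy≡xz ⟩
    x⁻¹ * (x * z) ≡⟨ *-assoc x⁻¹ x z ⟨
    x⁻¹ * x * z   ≡⟨ cong (_* z) x⁻¹x≡1 ⟩
    1# * z        ≡⟨ *-identityˡ z ⟩
    z             ∎
    where
    x⁻¹ = proj₁ (inverse x x≢0)
    x⁻¹x≡1 = trans (*-comm x⁻¹ x) (proj₂ (inverse x x≢0))

  xy≡0⇒y≡0 : ∀ {x y} → x ≢ 0# → x * y ≡ 0# → y ≡ 0#
  xy≡0⇒y≡0 {x} x≢0 xy≡0 = *-cancelˡ x≢0 (trans xy≡0 (sym (zeroʳ x)))

  x*y≢0 : ∀ {x y} → x ≢ 0# → y ≢ 0# → x * y ≢ 0#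
  x*y≢0 x≢0 y≢0 = y≢0 ∘′ xy≡0⇒y≡0 x≢0

  ·'≡× : ∀ k x → k ·' x ≡ k ×ᴿ x
  ·'≡× zero    x = refl
  ·'≡× (suc k) x = cong (x +_) (·'≡× k x)

  ^'≡^ : ∀ x n → x ^' n ≡ x ^ᴿ n
  ^'≡^ x zero    = refl
  ^'≡^ x (suc n) = cong (x *_) (^'≡^ x n)

  ^'-assocʳ : ∀ x m n → (x ^' m) ^' n ≡ x ^' (m ℕ.* n)
  ^'-assocʳ x m n = begin
    (x ^' m) ^' n ≡⟨ trans (^'≡^ (x ^' m) n) (cong (_^ᴿ n) (^'≡^ x m)) ⟩
    (x ^ᴿ m) ^ᴿ n  ≡⟨ ^-assocʳ x m n ⟩
    x ^ᴿ (m ℕ.* n) ≡⟨ ^'≡^ x (m ℕ.* n) ⟨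
    x ^' (m ℕ.* n) ∎

  ^'-distrib-* : ∀ x y n → (x * y) ^' n ≡ x ^' n * y ^' n
  ^'-distrib-* x y n = begin
    (x * y) ^' n    ≡⟨ ^'≡^ (x * y) n ⟩
    (x * y) ^ᴿ n    ≡⟨ ^-distrib-* x y n ⟩
    x ^ᴿ n * y ^ᴿ n ≡⟨ cong₂ _*_ (^'≡^ x n) (^'≡^ y n) ⟨
    x ^' n * y ^' n ∎

  1^'n≡1 : ∀ n → 1# ^' n ≡ 1#
  1^'n≡1 zero    = refl
  1^'n≡1 (suc n) = trans (*-identityˡ _) (1^'n≡1 n)

  x^'n≢0 : ∀ {x} n → x ≢ 0# → x ^' n ≢ 0#
  x^'n≢0 zero    x≢0 = 1≢0
  x^'n≢0 (suc n) x≢0 = x*y≢0 x≢0 (x^'n≢0 n x≢0)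

  ι : ℕ → Carrier
  ι k = k ·' 1#

  ι-homo-+ : ∀ m n → ι (m ℕ.+ n) ≡ ι m + ι n
  ι-homo-+ m n = begin
    ι (m ℕ.+ n)       ≡⟨ ·'≡× (m ℕ.+ n) 1# ⟩
    (m ℕ.+ n) ×ᴿ 1#   ≡⟨ ×-homo-+ 1# m n ⟩
    m ×ᴿ 1# + n ×ᴿ 1# ≡⟨ cong₂ _+_ (·'≡× m 1#) (·'≡× n 1#) ⟨
    ι m + ι n         ∎

  ι-homo-* : ∀ m n → ι (m ℕ.* n) ≡ ι m * ι n
  ι-homo-* m n = begin
    ι (m ℕ.* n)       ≡⟨ ·'≡× (m ℕ.* n) 1# ⟩
    (m ℕ.* n) ×ᴿ 1#   ≡⟨ ×1-homo-* m n ⟩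
    m ×ᴿ 1# * n ×ᴿ 1# ≡⟨ cong₂ _*_ (·'≡× m 1#) (·'≡× n 1#) ⟨
    ι m * ι n         ∎

  ι-homo-^ : ∀ k n → ι (k ℕ.^ n) ≡ ι k ^' n
  ι-homo-^ k zero    = +-identityʳ 1#
  ι-homo-^ k (suc n) = trans (ι-homo-* k (k ℕ.^ n)) (cong (ι k *_) (ι-homo-^ k n))

  ·'≡ι* : ∀ k x → k ·' x ≡ ι k * x
  ·'≡ι* zero    x = sym (zeroˡ x)
  ·'≡ι* (suc k) x = begin
    x + k ·' x       ≡⟨ cong₂ _+_ (sym (*-identityˡ x)) (·'≡ι* k x) ⟩
    1# * x + ι k * x ≡⟨ distribʳ x 1# (ι k) ⟨
    (1# + ι k) * x   ∎

  p∣k⇒k·'x≡0 : ∀ {p k} → ι p ≡ 0# → p ∣ k → ∀ x → k ·' x ≡ 0#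
  p∣k⇒k·'x≡0 {p} char (divides m refl) x = begin
    (m ℕ.* p) ·' x    ≡⟨ ·'≡ι* (m ℕ.* p) x ⟩
    ι (m ℕ.* p) * x   ≡⟨ cong (_* x) (ι-homo-* m p) ⟩
    ι m * ι p * x     ≡⟨ cong (λ c → ι m * c * x) char ⟩
    ι m * 0# * x      ≡⟨ cong (_* x) (zeroʳ (ι m)) ⟩
    0# * x            ≡⟨ zeroˡ x ⟩
    0#                ∎

  frobenius-+ : ∀ {p} → Prime p → ι p ≡ 0# → ∀ x y → (x + y) ^' p ≡ x ^' p + y ^' p
  frobenius-+ {suc (suc n)} p-prime char x y = begin
    (x + y) ^' p                               ≡⟨ ^'≡^ (x + y) p ⟩
    (x + y) ^ᴿ p                               ≡⟨ Binomial.theorem p x y ⟩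
    term 0F + ∑[ k < p ] term (Fin.suc k)      ≡⟨ cong (term 0F +_) (sum-init-last (term ∘′ Fin.suc)) ⟩
    term 0F + (∑[ k < suc n ] middle k + term (Fin.fromℕ p))
      ≡⟨ cong (λ s → term 0F + (s + term (Fin.fromℕ p))) (trans (sum-cong-≗ middle≡0) (sum-replicate-zero (suc n))) ⟩
    term 0F + (0# + term (Fin.fromℕ p))        ≡⟨ cong₂ _+_ term₀ (trans (+-identityˡ _) termₚ) ⟩
    y ^' p + x ^' p                            ≡⟨ +-comm (y ^' p) (x ^' p) ⟩
    x ^' p + y ^' p                            ∎
    where
    p = suc (suc n)
    term = Binomial.binomialTerm x y p
    middle : Fin (suc n) → Carrier
    middle k = term (Fin.suc (Fin.inject₁ k))
    middle≡0 : ∀ k → middle k ≡ 0#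
    middle≡0 k = trans (sym (·'≡× (p C toℕ k′) _)) (p∣k⇒k·'x≡0 char (prime∣pCk p-prime (s≤s z≤n) k′<p) _)
      where
      k′ = Fin.suc (Fin.inject₁ k)
      k′<p : toℕ k′ < p
      k′<p = s≤s (subst (_< suc n) (sym (Fin.toℕ-inject₁ k)) (Fin.toℕ<n k))
    term₀ : term 0F ≡ y ^' p
    term₀ = trans (+-identityʳ _) (trans (*-identityˡ _) (sym (^'≡^ y p)))
    termₚ : term (Fin.fromℕ p) ≡ x ^' p
    termₚ = begin
      term (Fin.fromℕ p)                      ≡⟨ cong (λ k → (p C k) ×ᴿ (x ^ᴿ k * y ^ᴿ (p ∸ k))) (Fin.toℕ-fromℕ p) ⟩
      (p C p) ×ᴿ (x ^ᴿ p * y ^ᴿ (p ∸ p))      ≡⟨ cong₂ (λ c e → c ×ᴿ (x ^ᴿ p * y ^ᴿ e)) (nCn≡1 p) (ℕ.n∸n≡0 p) ⟩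
      1 ×ᴿ (x ^ᴿ p * 1#)                      ≡⟨ trans (+-identityʳ _) (*-identityʳ _) ⟩
      x ^ᴿ p                                  ≡⟨ ^'≡^ x p ⟨
      x ^' p                                  ∎

  ∏-≢0 : ∀ {n} (f : Fin n → Carrier) → (∀ i → f i ≢ 0#) → ∏ f ≢ 0#
  ∏-≢0 {zero}  f f≢0 = 1≢0
  ∏-≢0 {suc n} f f≢0 = x*y≢0 (f≢0 0F) (∏-≢0 (f ∘′ Fin.suc) (λ i → f≢0 (Fin.suc i)))

  ∏-all-but-one : ∀ {n c} (f : Fin n → Carrier) (i : Fin n) → f i ≡ 1# → (∀ j → j ≢ i → f j ≡ c) →
                  ∏ f ≡ c ^' ℕ.pred n
  ∏-all-but-one {suc n} {c} f i fi≡1 fj≡c = begin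
    ∏ f                          ≡⟨ ∏-remove f ⟩
    f i * ∏ (removeAt f i)       ≡⟨ cong₂ _*_ fi≡1 (∏-cong-≗ (λ j → fj≡c (Fin.punchIn i j) (Fin.punchInᵢ≢i i j))) ⟩
    1# * ∏ {n} (λ _ → c)         ≡⟨ *-identityˡ _ ⟩
    ∏ {n} (λ _ → c)              ≡⟨ ∏-replicate n ⟩
    c ^ᴿ n                       ≡⟨ ^'≡^ c n ⟨
    c ^' n                       ∎

  +-translation : Carrier → Carrier ↔ Carrier
  +-translation c = mk↔ₛ′ (_+ c) (_- c) (λ x → x-y+y≡x c x) (λ x → x+y-y≡x c x)

  *-dilation : ∀ {c} → c ≢ 0# → Carrier ↔ Carrier
  *-dilation {c} c≢0 = mk↔ₛ′ (c *_) (c⁻¹ *_) (cancel c c⁻¹ cc⁻¹≡1) (cancel c⁻¹ c c⁻¹c≡1)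
    where
    c⁻¹ = proj₁ (inverse c c≢0)
    cc⁻¹≡1 = proj₂ (inverse c c≢0)
    c⁻¹c≡1 = trans (*-comm c⁻¹ c) cc⁻¹≡1
    cancel : ∀ a b → a * b ≡ 1# → ∀ x → a * (b * x) ≡ x
    cancel a b ab≡1 x = trans (sym (*-assoc a b x)) (trans (cong (_* x) ab≡1) (*-identityˡ x))

  -- A vector c₀ ∷ ⋯ ∷ cₙ₋₁ stands for the monic polynomial Xⁿ + cₙ₋₁Xⁿ⁻¹ + ⋯ + c₀.
  evalMonic : ∀ {n} → Vec Carrier n → Carrier → Carrier
  evalMonic []       x = 1#
  evalMonic (c ∷ cs) x = c + x * evalMonic cs x

  evalMonic-replicate : ∀ n x → evalMonic (replicate n 0#) x ≡ x ^' n
  evalMonic-replicate zero    x = refl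
  evalMonic-replicate (suc n) x = trans (+-identityˡ _) (cong (x *_) (evalMonic-replicate n x))

  quotient : ∀ {n} → Carrier → Vec Carrier (suc n) → Vec Carrier n
  quotient r (c ∷ [])     = []
  quotient r (c ∷ d ∷ cs) = evalMonic (d ∷ cs) r ∷ quotient r (d ∷ cs)

  evalMonic-quotient : ∀ {n} r (f : Vec Carrier (suc n)) x →
                       evalMonic f x ≡ (x - r) * evalMonic (quotient r f) x + evalMonic f r
  evalMonic-quotient r (c ∷ []) x = sym (begin
    (x - r) * 1# + (c + r * 1#)       ≡⟨ solve 5 (λ x r- c r o → (x :+ r-) :* o :+ (c :+ r :* o)
                                                          := c :+ x :* o :+ (r :+ r-) :* o) refl x (- r) c r 1# ⟩
    c + x * 1# + (r - r) * 1#         ≡⟨ cong (λ z → c + x * 1# + z * 1#) (-‿inverseʳ r) ⟩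
    c + x * 1# + 0# * 1#              ≡⟨ trans (cong (c + x * 1# +_) (zeroˡ 1#)) (+-identityʳ _) ⟩
    c + x * 1#                        ∎)
    where open RingSolver
  evalMonic-quotient r (c ∷ d ∷ cs) x = begin
    c + x * evalMonic (d ∷ cs) x
      ≡⟨ cong (λ z → c + x * z) (evalMonic-quotient r (d ∷ cs) x) ⟩
    c + x * ((x - r) * q + g)
      ≡⟨ trans (cong (c + x * ((x - r) * q + g) +_) (zeroˡ g)) (+-identityʳ _) ⟨
    c + x * ((x - r) * q + g) + 0# * g
      ≡⟨ cong (λ z → c + x * ((x - r) * q + g) + z * g) (-‿inverseʳ r) ⟨
    c + x * ((x - r) * q + g) + (r - r) * g
      ≡⟨ solve 6 (λ x r- c r q g → c :+ x :* ((x :+ r-) :* q :+ g) :+ (r :+ r-) :* g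
                                  := (x :+ r-) :* (g :+ x :* q) :+ (c :+ r :* g)) refl x (- r) c r q g ⟩
    (x - r) * (g + x * q) + (c + r * g)
      ∎
    where
    open RingSolver
    q = evalMonic (quotient r (d ∷ cs)) x
    g = evalMonic (d ∷ cs) r

  quotient-root : ∀ {n} {r x} (f : Vec Carrier (suc n)) → evalMonic f r ≡ 0# → evalMonic f x ≡ 0# → x ≢ r →
                  evalMonic (quotient r f) x ≡ 0#
  quotient-root {r = r} {x} f fr≡0 fx≡0 x≢r = xy≡0⇒y≡0 (x≢r ∘′ x-y≡0⇒x≡y x r) (begin
    (x - r) * evalMonic (quotient r f) x                  ≡⟨ +-identityʳ _ ⟨
    (x - r) * evalMonic (quotient r f) x + 0#             ≡⟨ cong ((x - r) * evalMonic (quotient r f) x +_) fr≡0 ⟨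
    (x - r) * evalMonic (quotient r f) x + evalMonic f r  ≡⟨ evalMonic-quotient r f x ⟨
    evalMonic f x                                         ≡⟨ fx≡0 ⟩
    0#                                                    ∎)

  distinct-roots≤degree : ∀ {m n} (f : Vec Carrier n) (rs : Fin m → Carrier) → Injective _≡_ _≡_ rs →
                          (∀ i → evalMonic f (rs i) ≡ 0#) → m ≤ n
  distinct-roots≤degree {zero}          f  rs rs-inj roots = z≤n
  distinct-roots≤degree {suc m} {zero}  [] rs rs-inj roots = contradiction (roots 0F) 1≢0
  distinct-roots≤degree {suc m} {suc n} f  rs rs-inj roots =
    s≤s (distinct-roots≤degree (quotient (rs 0F) f) (rs ∘′ Fin.suc) (Fin.suc-injective ∘′ rs-inj)
          (λ i → quotient-root f (roots 0F) (roots (Fin.suc i)) (Fin.0≢1+n ∘′ sym ∘′ rs-inj)))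

  [x-y][x+y]≡x*x-y*y : ∀ x y → (x - y) * (x + y) ≡ x * x - y * y
  [x-y][x+y]≡x*x-y*y x y = begin
    (x - y) * (x + y)
      ≡⟨ solve 3 (λ x y y- → (x :+ y-) :* (x :+ y) := x :* x :+ y- :* y :+ x :* (y :+ y-)) refl x y (- y) ⟩
    x * x + - y * y + x * (y - y)
      ≡⟨ cong₂ (λ s t → x * x + s + x * t) (sym (-‿distribˡ-* y y)) (-‿inverseʳ y) ⟩
    x * x - y * y + x * 0#
      ≡⟨ trans (cong (x * x - y * y +_) (zeroʳ x)) (+-identityʳ _) ⟩
    x * x - y * y
      ∎
    where open RingSolver

  module _ (_≟_ : DecidableEquality Carrier) where

    x*x≡y*y⇒x≡±y : ∀ {x y} → x * x ≡ y * y → x ≡ y ⊎ x ≡ - y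
    x*x≡y*y⇒x≡±y {x} {y} x²≡y² with (x - y) ≟ 0#
    ... | yes x-y≡0 = inj₁ (x-y≡0⇒x≡y x y x-y≡0)
    ... | no  x-y≢0 = inj₂ (x+y≡0⇒x≡-y x y (xy≡0⇒y≡0 x-y≢0 (begin
      (x - y) * (x + y)  ≡⟨ [x-y][x+y]≡x*x-y*y x y ⟩
      x * x - y * y      ≡⟨ cong (_- y * y) x²≡y² ⟩
      y * y - y * y      ≡⟨ -‿inverseʳ (y * y) ⟩
      0#                 ∎)))

    distinct-roots-exhaustive : ∀ {n} (f : Vec Carrier n) (rs : Fin n → Carrier) → Injective _≡_ _≡_ rs →
                                (∀ i → evalMonic f (rs i) ≡ 0#) → ∀ {z} → evalMonic f z ≡ 0# → ∃ λ i → z ≡ rs i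
    distinct-roots-exhaustive {n} f rs rs-inj roots {z} fz≡0 with Fin.any? (λ i → z ≟ rs i)
    ... | yes z∈rs = z∈rs
    ... | no  z∉rs = contradiction (distinct-roots≤degree f (z ∷ᶠ rs) z∷rs-inj z∷rs-roots) (ℕ.<-irrefl refl)
      where
      z∷rs-inj : Injective _≡_ _≡_ (z ∷ᶠ rs)
      z∷rs-inj {0F}       {0F}       _  = refl
      z∷rs-inj {0F}       {Fin.suc j} eq = contradiction (j , eq) z∉rs
      z∷rs-inj {Fin.suc i} {0F}       eq = contradiction (i , sym eq) z∉rs
      z∷rs-inj {Fin.suc i} {Fin.suc j} eq = cong Fin.suc (rs-inj eq)
      z∷rs-roots : ∀ i → evalMonic f ((z ∷ᶠ rs) i) ≡ 0#
      z∷rs-roots 0F          = fz≡0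
      z∷rs-roots (Fin.suc i) = roots i

  module Characteristic {p} (p-prime : Prime p) (char : ι p ≡ 0#) where

    -- The prime field, as the fixed points of the Frobenius map.
    𝔽ₚ : Carrier → Set
    𝔽ₚ μ = μ ^' p ≡ μ

    ^p-+ : ∀ x y → (x + y) ^' p ≡ x ^' p + y ^' p
    ^p-+ = frobenius-+ p-prime char

    ^p-0 : 0# ^' p ≡ 0#
    ^p-0 = x+y≡x⇒y≡0 (0# ^' p) (0# ^' p) (trans (sym (^p-+ 0# 0#)) (cong (_^' p) (+-identityʳ 0#)))

    ^p-neg : ∀ x → (- x) ^' p ≡ - (x ^' p)
    ^p-neg x = x+y≡0⇒x≡-y ((- x) ^' p) (x ^' p)
      (trans (sym (^p-+ (- x) x)) (trans (cong (_^' p) (-‿inverseˡ x)) ^p-0))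

    ^p-·' : ∀ k x → (k ·' x) ^' p ≡ k ·' (x ^' p)
    ^p-·' zero    x = ^p-0
    ^p-·' (suc k) x = trans (^p-+ x (k ·' x)) (cong (x ^' p +_) (^p-·' k x))

    ι∈𝔽ₚ : ∀ k → 𝔽ₚ (ι k)
    ι∈𝔽ₚ k = trans (^p-·' k 1#) (cong (k ·'_) (1^'n≡1 p))

    𝔽ₚ-+ : ∀ {μ ν} → 𝔽ₚ μ → 𝔽ₚ ν → 𝔽ₚ (μ + ν)
    𝔽ₚ-+ {μ} {ν} μ∈𝔽ₚ ν∈𝔽ₚ = trans (^p-+ μ ν) (cong₂ _+_ μ∈𝔽ₚ ν∈𝔽ₚ)

    𝔽ₚ-* : ∀ {μ ν} → 𝔽ₚ μ → 𝔽ₚ ν → 𝔽ₚ (μ * ν)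
    𝔽ₚ-* {μ} {ν} μ∈𝔽ₚ ν∈𝔽ₚ = trans (^'-distrib-* μ ν p) (cong₂ _*_ μ∈𝔽ₚ ν∈𝔽ₚ)

    𝔽ₚ-neg : ∀ {μ} → 𝔽ₚ μ → 𝔽ₚ (- μ)
    𝔽ₚ-neg {μ} μ∈𝔽ₚ = trans (^p-neg μ) (cong -_ μ∈𝔽ₚ)

    𝔽ₚ-inverse : ∀ {μ ν} → 𝔽ₚ μ → μ ≢ 0# → ν * μ ≡ 1# → 𝔽ₚ ν
    𝔽ₚ-inverse {μ} {ν} μ∈𝔽ₚ μ≢0 νμ≡1 = *-cancelˡ μ≢0 (begin
      μ * ν ^' p        ≡⟨ cong (_* ν ^' p) μ∈𝔽ₚ ⟨
      μ ^' p * ν ^' p   ≡⟨ ^'-distrib-* μ ν p ⟨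
      (μ * ν) ^' p      ≡⟨ cong (_^' p) (trans (*-comm μ ν) νμ≡1) ⟩
      1# ^' p           ≡⟨ 1^'n≡1 p ⟩
      1#                ≡⟨ trans (*-comm μ ν) νμ≡1 ⟨
      μ * ν             ∎)

    x^'[p∸2]*x≡1 : ∀ {μ} → 𝔽ₚ μ → μ ≢ 0# → μ ^' (p ∸ 2) * μ ≡ 1#
    x^'[p∸2]*x≡1 {μ} μ∈𝔽ₚ μ≢0 = *-cancelˡ μ≢0 (begin
      μ * (μ ^' (p ∸ 2) * μ)  ≡⟨ cong (μ *_) (*-comm (μ ^' (p ∸ 2)) μ) ⟩
      μ ^' (2 ℕ.+ (p ∸ 2))    ≡⟨ cong (μ ^'_) (ℕ.m+[n∸m]≡n (nonTrivial⇒n>1 p {{prime⇒nonTrivial p-prime}})) ⟩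
      μ ^' p                  ≡⟨ μ∈𝔽ₚ ⟩
      μ                       ≡⟨ *-identityʳ μ ⟨
      μ * 1#                  ∎)

    ι-inverse : ∀ k → ι k ≢ 0# → ι (k ℕ.^ (p ∸ 2)) * ι k ≡ 1#
    ι-inverse k ιk≢0 = trans (cong (_* ι k) (ι-homo-^ k (p ∸ 2))) (x^'[p∸2]*x≡1 (ι∈𝔽ₚ k) ιk≢0)

    ι[m*k]≡0 : ∀ {k} → ι k ≡ 0# → ∀ m → ι (m ℕ.* k) ≡ 0#
    ι[m*k]≡0 {k} ιk≡0 m = trans (ι-homo-* m k) (trans (cong (ι m *_) ιk≡0) (zeroʳ (ι m)))

    1+m*k≢n*l : ∀ {k l} → ι k ≡ 0# → ι l ≡ 0# → ∀ m n → 1 ℕ.+ m ℕ.* k ≢ n ℕ.* l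
    1+m*k≢n*l {k} {l} ιk≡0 ιl≡0 m n eq = 1≢0 (begin
      1#                      ≡⟨ +-identityʳ 1# ⟨
      1# + 0#                 ≡⟨ cong (1# +_) (ι[m*k]≡0 ιk≡0 m) ⟨
      ι (1 ℕ.+ m ℕ.* k)       ≡⟨ cong ι eq ⟩
      ι (n ℕ.* l)             ≡⟨ ι[m*k]≡0 ιl≡0 n ⟩
      0#                      ∎)

    ι≢0 : ∀ {k} → 0 < k → k < p → ι k ≢ 0#
    ι≢0 {suc k} _ k<p ιk≡0 with coprime-Bézout (prime⇒coprime p-prime k<p)
    ... | Bézout.+- m n eq = 1+m*k≢n*l ιk≡0 char n m eq
    ... | Bézout.-+ m n eq = 1+m*k≢n*l char ιk≡0 m n eq

    ι-<-distinct : ∀ {m n} → m < n → n < p → ι m ≢ ι n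
    ι-<-distinct {m} {n} m<n n<p ιm≡ιn = ι≢0 (ℕ.m<n⇒0<n∸m m<n) (ℕ.≤-<-trans (ℕ.m∸n≤m n m) n<p)
      (x+y≡x⇒y≡0 (ι m) (ι (n ∸ m)) (begin
        ι m + ι (n ∸ m)      ≡⟨ ι-homo-+ m (n ∸ m) ⟨
        ι (m ℕ.+ (n ∸ m))    ≡⟨ cong ι (ℕ.m+[n∸m]≡n (ℕ.<⇒≤ m<n)) ⟩
        ι n                  ≡⟨ ιm≡ιn ⟨
        ι m                  ∎))

    ι-injective : ∀ {m n} → m < p → n < p → ι m ≡ ι n → m ≡ n
    ι-injective {m} {n} m<p n<p ιm≡ιn with ℕ.<-cmp m n
    ... | tri< m<n _ _ = contradiction ιm≡ιn (ι-<-distinct m<n n<p)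
    ... | tri≈ _ m≡n _ = m≡n
    ... | tri> _ _ n<m = contradiction (sym ιm≡ιn) (ι-<-distinct n<m m<p)

    ι[p∸1]≡-1 : ι (p ∸ 1) ≡ - 1#
    ι[p∸1]≡-1 = x+y≡0⇒x≡-y (ι (p ∸ 1)) 1# (begin
      ι (p ∸ 1) + 1#       ≡⟨ +-comm (ι (p ∸ 1)) 1# ⟩
      ι (1 ℕ.+ (p ∸ 1))    ≡⟨ cong ι (ℕ.m+[n∸m]≡n (ℕ.<⇒≤ (nonTrivial⇒n>1 p {{prime⇒nonTrivial p-prime}}))) ⟩
      ι p                  ≡⟨ char ⟩
      0#                   ∎)

module QuadraticCharacter (F : Field) (_≟_ : DecidableEquality (Field.Carrier F)) (J : ℕ)
                          (p-prime : Prime (3 ℕ.+ 4 ℕ.* J))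
                          (char : FieldProperties.ι F (3 ℕ.+ 4 ℕ.* J) ≡ Field.0# F) where
  open Field F
  open FieldProperties F
  open Characteristic p-prime char
  open ≡-Reasoning

  p h : ℕ
  p = 3 ℕ.+ 4 ℕ.* J
  h = 1 ℕ.+ 2 ℕ.* J

  1+[h+h]≡p : suc (h ℕ.+ h) ≡ p
  1+[h+h]≡p = solve 1 (λ J → con 1 :+ ((con 1 :+ con 2 :* J) :+ (con 1 :+ con 2 :* J)) := con 3 :+ con 4 :* J)
                refl J
    where open +-*-Solver

  h<p : h < p
  h<p = subst (h <_) 1+[h+h]≡p (s≤s (ℕ.m≤m+n h h))

  -1^'h≡-1 : (- 1#) ^' h ≡ - 1#
  -1^'h≡-1 = begin
    - 1# * (- 1#) ^' (2 ℕ.* J)     ≡⟨ cong (- 1# *_) (^'-assocʳ (- 1#) 2 J) ⟨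
    - 1# * ((- 1#) ^' 2) ^' J      ≡⟨ cong (λ x → - 1# * x ^' J) (trans (cong (- 1# *_) (*-identityʳ _)) -1*-1≡1) ⟩
    - 1# * 1# ^' J                 ≡⟨ cong (- 1# *_) (1^'n≡1 J) ⟩
    - 1# * 1#                      ≡⟨ *-identityʳ (- 1#) ⟩
    - 1#                           ∎
    where
    -1*-1≡1 : - 1# * - 1# ≡ 1#
    -1*-1≡1 = trans (-1*x≈-x (- 1#)) (-‿involutive 1#)

  [-x]^'h≡-x^'h : ∀ x → (- x) ^' h ≡ - (x ^' h)
  [-x]^'h≡-x^'h x = begin
    (- x) ^' h           ≡⟨ cong (_^' h) (-1*x≈-x x) ⟨
    (- 1# * x) ^' h      ≡⟨ ^'-distrib-* (- 1#) x h ⟩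
    (- 1#) ^' h * x ^' h ≡⟨ cong (_* x ^' h) -1^'h≡-1 ⟩
    - 1# * x ^' h        ≡⟨ -1*x≈-x (x ^' h) ⟩
    - (x ^' h)           ∎

  [x*x]^'h≡1 : ∀ {μ} → 𝔽ₚ μ → μ ≢ 0# → (μ * μ) ^' h ≡ 1#
  [x*x]^'h≡1 {μ} μ∈𝔽ₚ μ≢0 = begin
    (μ * μ) ^' h              ≡⟨ cong (_^' h) (cong (μ *_) (*-identityʳ μ)) ⟨
    (μ ^' 2) ^' h             ≡⟨ ^'-assocʳ μ 2 h ⟩
    μ ^' (2 ℕ.* h)            ≡⟨ cong (μ ^'_) 2h≡1+[p∸2] ⟩
    μ * μ ^' (p ∸ 2)          ≡⟨ *-comm μ (μ ^' (p ∸ 2)) ⟩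
    μ ^' (p ∸ 2) * μ          ≡⟨ x^'[p∸2]*x≡1 μ∈𝔽ₚ μ≢0 ⟩
    1#                        ∎
    where
    2h≡1+[p∸2] : 2 ℕ.* h ≡ suc (p ∸ 2)
    2h≡1+[p∸2] = solve 1 (λ J → con 2 :* (con 1 :+ con 2 :* J) := con 2 :+ con 4 :* J) refl J
      where open +-*-Solver

  x*x≢-1 : ∀ {μ} → 𝔽ₚ μ → μ * μ ≢ - 1#
  x*x≢-1 {μ} μ∈𝔽ₚ μ²≡-1 = ι≢0 {2} (s≤s z≤n) (s≤s (s≤s (s≤s z≤n))) (begin
    1# + (1# + 0#)     ≡⟨ cong (1# +_) (trans (+-identityʳ 1#) 1≡-1) ⟩
    1# + - 1#          ≡⟨ -‿inverseʳ 1# ⟩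
    0#                 ∎)
    where
    μ≢0 : μ ≢ 0#
    μ≢0 μ≡0 = -1≢0 (trans (sym μ²≡-1) (trans (cong (_* μ) μ≡0) (zeroˡ μ)))
    1≡-1 : 1# ≡ - 1#
    1≡-1 = trans (sym ([x*x]^'h≡1 μ∈𝔽ₚ μ≢0)) (trans (cong (_^' h) μ²≡-1) -1^'h≡-1)

  no-𝔽ₚ-eigenvalue : ∀ {c μ} → c ≢ 0# → (c ^' p) ^' p ≡ - c → 𝔽ₚ μ → c ^' p ≢ μ * c
  no-𝔽ₚ-eigenvalue {c} {μ} c≢0 c^p²≡-c μ∈𝔽ₚ c^p≡μc = x*x≢-1 μ∈𝔽ₚ (*-cancelˡ c≢0 (begin
    c * (μ * μ)       ≡⟨ solve 2 (λ c μ → c :* (μ :* μ) := μ :* (μ :* c)) refl c μ ⟩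
    μ * (μ * c)       ≡⟨ cong₂ _*_ μ∈𝔽ₚ c^p≡μc ⟨
    μ ^' p * c ^' p   ≡⟨ ^'-distrib-* μ c p ⟨
    (μ * c) ^' p      ≡⟨ cong (_^' p) c^p≡μc ⟨
    (c ^' p) ^' p     ≡⟨ c^p²≡-c ⟩
    - c               ≡⟨ cong -_ (*-identityʳ c) ⟨
    - (c * 1#)        ≡⟨ -‿distribʳ-* c 1# ⟩
    c * - 1#          ∎))
    where open RingSolver

  square : Fin h → Carrier
  square i = ι (suc (toℕ i)) * ι (suc (toℕ i))

  1+i<p : ∀ (i : Fin h) → suc (toℕ i) < p
  1+i<p i = ℕ.≤-<-trans (Fin.toℕ<n i) h<p

  square-injective : Injective _≡_ _≡_ square
  square-injective {i} {i′} eq with x*x≡y*y⇒x≡±y _≟_ eq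
  ... | inj₁ ιj≡ιj′  = Fin.toℕ-injective (ℕ.suc-injective (ι-injective (1+i<p i) (1+i<p i′) ιj≡ιj′))
  ... | inj₂ ιj≡-ιj′ = contradiction ι[j+j′]≡0 (ι≢0 (s≤s z≤n) j+j′<p)
    where
    j = suc (toℕ i)
    j′ = suc (toℕ i′)
    j+j′<p : j ℕ.+ j′ < p
    j+j′<p = subst (j ℕ.+ j′ <_) 1+[h+h]≡p (s≤s (ℕ.+-mono-≤ (Fin.toℕ<n i) (Fin.toℕ<n i′)))
    ι[j+j′]≡0 : ι (j ℕ.+ j′) ≡ 0#
    ι[j+j′]≡0 = trans (ι-homo-+ j j′) (trans (cong (_+ ι j′) ιj≡-ιj′) (-‿inverseˡ (ι j′)))

  Xʰ-1 : Vec Carrier h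
  Xʰ-1 = - 1# ∷ replicate (2 ℕ.* J) 0#

  x^'h≡1⇒root : ∀ {x} → x ^' h ≡ 1# → evalMonic Xʰ-1 x ≡ 0#
  x^'h≡1⇒root {x} x^h≡1 = begin
    - 1# + x * evalMonic (replicate (2 ℕ.* J) 0#) x  ≡⟨ cong (λ y → - 1# + x * y) (evalMonic-replicate (2 ℕ.* J) x) ⟩
    - 1# + x ^' h                                    ≡⟨ cong (- 1# +_) x^h≡1 ⟩
    - 1# + 1#                                        ≡⟨ -‿inverseˡ 1# ⟩
    0#                                               ∎

  x^'h≡1⇒square : ∀ {x} → x ^' h ≡ 1# → ∃ λ i → x ≡ square i
  x^'h≡1⇒square x^h≡1 = distinct-roots-exhaustive _≟_ Xʰ-1 square square-injective
    (λ i → x^'h≡1⇒root ([x*x]^'h≡1 (ι∈𝔽ₚ (suc (toℕ i))) (ι≢0 (s≤s z≤n) (1+i<p i))))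
    (x^'h≡1⇒root x^h≡1)

  x^'h≡-1⇒antisquare : ∀ {μ} → μ ^' h ≡ - 1# → ∃ λ i → μ * square i ≡ - 1#
  x^'h≡-1⇒antisquare {μ} μ^h≡-1 = i , (begin
    μ * square i     ≡⟨ cong (μ *_) -w≡square ⟨
    μ * - w          ≡⟨ -‿distribʳ-* μ w ⟨
    - (μ * w)        ≡⟨ cong -_ μw≡1 ⟩
    - 1#             ∎)
    where
    μ≢0 : μ ≢ 0#
    μ≢0 μ≡0 = -1≢0 (trans (sym μ^h≡-1) (trans (cong (_^' h) μ≡0) (zeroˡ _)))
    w = proj₁ (inverse μ μ≢0)
    μw≡1 = proj₂ (inverse μ μ≢0)
    [-w]^h≡1 : (- w) ^' h ≡ 1#
    [-w]^h≡1 = begin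
      (- w) ^' h        ≡⟨ [-x]^'h≡-x^'h w ⟩
      - (w ^' h)        ≡⟨ cong -_ (*-identityʳ _) ⟨
      - (w ^' h * 1#)   ≡⟨ -‿distribʳ-* (w ^' h) 1# ⟩
      w ^' h * - 1#     ≡⟨ cong (w ^' h *_) μ^h≡-1 ⟨
      w ^' h * μ ^' h   ≡⟨ ^'-distrib-* w μ h ⟨
      (w * μ) ^' h      ≡⟨ cong (_^' h) (trans (*-comm w μ) μw≡1) ⟩
      1# ^' h           ≡⟨ 1^'n≡1 h ⟩
      1#                ∎
    i = proj₁ (x^'h≡1⇒square [-w]^h≡1)
    -w≡square = proj₂ (x^'h≡1⇒square [-w]^h≡1)

  x^'h≡±1 : ∀ {μ} → 𝔽ₚ μ → μ ≢ 0# → μ ^' h ≡ 1# ⊎ μ ^' h ≡ - 1#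
  x^'h≡±1 {μ} μ∈𝔽ₚ μ≢0 = x*x≡y*y⇒x≡±y _≟_ (begin
    μ ^' h * μ ^' h    ≡⟨ ^'-distrib-* μ μ h ⟨
    (μ * μ) ^' h       ≡⟨ [x*x]^'h≡1 μ∈𝔽ₚ μ≢0 ⟩
    1#                 ≡⟨ *-identityˡ 1# ⟨
    1# * 1#            ∎)

  ι-square-or-antisquare : ∀ n → ∃ λ j → j ≤ h × (ι n ≡ ι j * ι j ⊎ ι n * (ι j * ι j) ≡ - 1#)
  ι-square-or-antisquare n with ι n ≟ 0#
  ... | yes ιn≡0 = 0 , z≤n , inj₁ (trans ιn≡0 (sym (zeroˡ 0#)))
  ... | no  ιn≢0 with x^'h≡±1 (ι∈𝔽ₚ n) ιn≢0
  ...   | inj₁ ιn^h≡1  =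
    let i , ιn≡square = x^'h≡1⇒square ιn^h≡1 in suc (toℕ i) , Fin.toℕ<n i , inj₁ ιn≡square
  ...   | inj₂ ιn^h≡-1 =
    let i , ιn*square≡-1 = x^'h≡-1⇒antisquare ιn^h≡-1 in suc (toℕ i) , Fin.toℕ<n i , inj₂ ιn*square≡-1

module FiniteFieldProperties {q} (K : FiniteField q) where
  open FiniteField K
  open FieldProperties field'
  open ≡-Reasoning

  toFin : Carrier → Fin q
  toFin = Inverse.to card

  fromFin : Fin q → Carrier
  fromFin = Inverse.from card

  fromFin-injective : Injective _≡_ _≡_ fromFin
  fromFin-injective = Injection.injective (↔⇒↣ (↔-sym card))

  _≟_ : DecidableEquality Carrier
  _≟_ = via-injection (↔⇒↣ card) Fin._≟_

  module _ (M : CommutativeMonoid 0ℓ 0ℓ) where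
    open CommutativeMonoid M using (_≈_; reflexive) renaming (Carrier to A; trans to ≈-trans)
    open import Algebra.Properties.CommutativeMonoid.Sum M using (sum; sum-permute; sum-cong-≗)

    ∑ᴷ : (Carrier → A) → A
    ∑ᴷ f = sum (f ∘′ fromFin)

    ∑ᴷ-invariant : (σ : Carrier ↔ Carrier) (f : Carrier → A) → ∑ᴷ f ≈ ∑ᴷ (f ∘′ Inverse.to σ)
    ∑ᴷ-invariant σ f = ≈-trans (sum-permute (f ∘′ fromFin) (card ↔-∘ (σ ↔-∘ ↔-sym card)))
      (reflexive (sum-cong-≗ (λ i → cong f (Inverse.strictlyInverseʳ card (Inverse.to σ (fromFin i))))))

  open import Algebra.Properties.CommutativeMonoid.Sum (CommutativeRing.+-commutativeMonoid ring)
    using (∑-distrib-+; sum-replicate)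
  open import Algebra.Properties.CommutativeMonoid.Sum (CommutativeRing.*-commutativeMonoid ring)
    using () renaming (∑-distrib-+ to ∏-distrib-*)

  Σᴷ Πᴷ : (Carrier → Carrier) → Carrier
  Σᴷ = ∑ᴷ (CommutativeRing.+-commutativeMonoid ring)
  Πᴷ = ∑ᴷ (CommutativeRing.*-commutativeMonoid ring)

  ι[q]≡0 : ι q ≡ 0#
  ι[q]≡0 = x+y≡x⇒y≡0 (Σᴷ id) (ι q) (sym (begin
    Σᴷ id                     ≡⟨ ∑ᴷ-invariant (CommutativeRing.+-commutativeMonoid ring) (+-translation 1#) id ⟩
    Σᴷ (_+ 1#)                ≡⟨ ∑-distrib-+ fromFin (λ _ → 1#) ⟩
    Σᴷ id + Σᴷ (λ _ → 1#)     ≡⟨ cong (Σᴷ id +_) (trans (sum-replicate q) (sym (·'≡× q 1#))) ⟩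
    Σᴷ id + ι q               ∎))

  whenNonzero : Carrier → Carrier → Carrier
  whenNonzero y c with y ≟ 0#
  ... | yes _ = 1#
  ... | no  _ = c

  whenNonzero-0 : ∀ c → whenNonzero 0# c ≡ 1#
  whenNonzero-0 c with 0# ≟ 0#
  ... | yes _   = refl
  ... | no  0≢0 = contradiction refl 0≢0

  whenNonzero-≢0 : ∀ {y} c → y ≢ 0# → whenNonzero y c ≡ c
  whenNonzero-≢0 {y} c y≢0 with y ≟ 0#
  ... | yes y≡0 = contradiction y≡0 y≢0
  ... | no  _   = refl

  whenNonzero-self-≢0 : ∀ y → whenNonzero y y ≢ 0#
  whenNonzero-self-≢0 y with y ≟ 0#
  ... | yes _   = 1≢0
  ... | no  y≢0 = y≢0

  whenNonzero-* : ∀ {c} y → c ≢ 0# → whenNonzero (c * y) (c * y) ≡ whenNonzero y c * whenNonzero y y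
  whenNonzero-* {c} y c≢0 with y ≟ 0# | (c * y) ≟ 0#
  ... | yes _   | yes _    = sym (*-identityˡ 1#)
  ... | yes y≡0 | no  cy≢0 = contradiction (trans (cong (c *_) y≡0) (zeroʳ c)) cy≢0
  ... | no  y≢0 | yes cy≡0 = contradiction cy≡0 (x*y≢0 c≢0 y≢0)
  ... | no  _   | no  _    = refl

  Πᴷ-whenNonzero : ∀ c → Πᴷ (λ y → whenNonzero y c) ≡ c ^' ℕ.pred q
  Πᴷ-whenNonzero c = ∏-all-but-one _ (toFin 0#)
    (trans (cong (λ y → whenNonzero y c) (Inverse.strictlyInverseʳ card 0#)) (whenNonzero-0 c))
    (λ j j≢0 → whenNonzero-≢0 c (λ y≡0 → j≢0 (trans (sym (Inverse.strictlyInverseˡ card j)) (cong toFin y≡0))))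

  -- Multiplying by x permutes K and multiplies the product P of the non-zero elements by x^(q-1).
  x^'[q-1]≡1 : ∀ {x} → x ≢ 0# → x ^' ℕ.pred q ≡ 1#
  x^'[q-1]≡1 {x} x≢0 = *-cancelˡ P≢0 (begin
    P * x ^' ℕ.pred q
      ≡⟨ *-comm P (x ^' ℕ.pred q) ⟩
    x ^' ℕ.pred q * P
      ≡⟨ cong (_* P) (Πᴷ-whenNonzero x) ⟨
    Πᴷ (λ y → whenNonzero y x) * P
      ≡⟨ ∏-distrib-* (λ i → whenNonzero (fromFin i) x) (λ i → whenNonzero (fromFin i) (fromFin i)) ⟨
    Πᴷ (λ y → whenNonzero y x * whenNonzero y y)
      ≡⟨ ∏-cong-≗ (λ i → whenNonzero-* (fromFin i) x≢0) ⟨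
    Πᴷ (λ y → whenNonzero (x * y) (x * y))
      ≡⟨ ∑ᴷ-invariant (CommutativeRing.*-commutativeMonoid ring) (*-dilation x≢0) (λ y → whenNonzero y y) ⟨
    P
      ≡⟨ *-identityʳ P ⟨
    P * 1#
      ∎)
    where
    P = Πᴷ (λ y → whenNonzero y y)
    P≢0 = ∏-≢0 _ (λ i → whenNonzero-self-≢0 (fromFin i))

  x^'q≡x : ∀ x → x ^' q ≡ x
  x^'q≡x x = trans (cong (x ^'_) (sym (ℕ.suc-pred q {{Fin.nonZeroIndex (toFin 0#)}}))) (x*x^'[q-1]≡x (x ≟ 0#))
    where
    x*x^'[q-1]≡x : Dec (x ≡ 0#) → x * x ^' ℕ.pred q ≡ x
    x*x^'[q-1]≡x (yes x≡0) = trans (cong (_* x ^' ℕ.pred q) x≡0) (trans (zeroˡ _) (sym x≡0))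
    x*x^'[q-1]≡x (no  x≢0) = trans (cong (x *_) (x^'[q-1]≡1 x≢0)) (*-identityʳ x)

  ∃-non-root : ∀ {n} (f : Vec Carrier n) → n < q → ∃ λ x → evalMonic f x ≢ 0#
  ∃-non-root {n} f n<q =
    let i , fᵢ≢0 = Fin.¬∀⟶∃¬ q (λ i → evalMonic f (fromFin i) ≡ 0#) (λ i → evalMonic f (fromFin i) ≟ 0#)
                     (λ all-roots → ℕ.<⇒≱ n<q (distinct-roots≤degree f fromFin fromFin-injective all-roots))
    in fromFin i , fᵢ≢0

module Theorem (J : ℕ) (p-prime : Prime (3 ℕ.+ 4 ℕ.* J)) (K : FiniteField ((3 ℕ.+ 4 ℕ.* J) ^ 4)) where
  p : ℕ
  p = 3 ℕ.+ 4 ℕ.* J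

  open FieldDefs K p
  open FieldProperties field'
  open FiniteFieldProperties K using (_≟_; ι[q]≡0; x^'q≡x; ∃-non-root)
  open ≡-Reasoning

  ι[p]≡0 : ι p ≡ 0#
  ι[p]≡0 with ι p ≟ 0#
  ... | yes ιp≡0 = ιp≡0
  ... | no  ιp≢0 = contradiction (trans (sym (ι-homo-^ p 4)) ι[q]≡0) (x^'n≢0 4 ιp≢0)

  open Characteristic p-prime ι[p]≡0
  open QuadraticCharacter field' _≟_ J p-prime ι[p]≡0 using (h; no-𝔽ₚ-eigenvalue; ι-square-or-antisquare)

  φ₁[x-y]≡φ₁x-φ₁y : ∀ x y → φ₁ (x - y) ≡ φ₁ x - φ₁ y
  φ₁[x-y]≡φ₁x-φ₁y x y = trans (^p-+ x (- y)) (cong (φ₁ x +_) (^p-neg y))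

  x^'[p^2]≡φ₁[φ₁x] : ∀ x → x ^' (p ^ 2) ≡ φ₁ (φ₁ x)
  x^'[p^2]≡φ₁[φ₁x] x = trans (cong (λ n → x ^' (p ℕ.* n)) (ℕ.*-identityʳ p)) (sym (^'-assocʳ x p p))

  G⇒φ₁[φ₁x]≡-x : ∀ {c} → G c → φ₁ (φ₁ c) ≡ - c
  G⇒φ₁[φ₁x]≡-x {c} Gc = x+y≡0⇒x≡-y (φ₁ (φ₁ c)) c (trans (cong (_+ c) (sym (x^'[p^2]≡φ₁[φ₁x] c))) Gc)

  φ₁[φ₁x]≡-x⇒G : ∀ {c} → φ₁ (φ₁ c) ≡ - c → G c
  φ₁[φ₁x]≡-x⇒G {c} φ₁φ₁c≡-c = trans (cong (_+ c) (trans (x^'[p^2]≡φ₁[φ₁x] c) φ₁φ₁c≡-c)) (-‿inverseˡ c)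

  φ₁⁴≡id : ∀ x → φ₁ (φ₁ (φ₁ (φ₁ x))) ≡ x
  φ₁⁴≡id x = begin
    φ₁ (φ₁ (φ₁ (φ₁ x)))          ≡⟨ x^'[p^2]≡φ₁[φ₁x] (φ₁ (φ₁ x)) ⟨
    φ₁ (φ₁ x) ^' (p ^ 2)         ≡⟨ cong (_^' (p ^ 2)) (x^'[p^2]≡φ₁[φ₁x] x) ⟨
    (x ^' (p ^ 2)) ^' (p ^ 2)    ≡⟨ ^'-assocʳ x (p ^ 2) (p ^ 2) ⟩
    x ^' (p ^ 2 ℕ.* p ^ 2)       ≡⟨ cong (x ^'_) (ℕ.^-distribˡ-+-* p 2 2) ⟨
    x ^' (p ^ 4)                 ≡⟨ x^'q≡x x ⟩
    x                            ∎

  -- X^(p * p) + cX; the length checks because p * p reduces to suc (suc (p * p ∸ 2)) for p = 3 + 4J.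
  X^[p*p]+cX : Carrier → Vec Carrier (p ℕ.* p)
  X^[p*p]+cX c = 0# ∷ c ∷ replicate (p ℕ.* p ∸ 2) 0#

  evalMonic-X^[p*p]+cX : ∀ c x → evalMonic (X^[p*p]+cX c) x ≡ φ₁ (φ₁ x) + c * x
  evalMonic-X^[p*p]+cX c x = begin
    0# + x * (c + x * evalMonic (replicate (p ℕ.* p ∸ 2) 0#) x)
      ≡⟨ +-identityˡ _ ⟩
    x * (c + x * evalMonic (replicate (p ℕ.* p ∸ 2) 0#) x)
      ≡⟨ cong (λ y → x * (c + x * y)) (evalMonic-replicate (p ℕ.* p ∸ 2) x) ⟩
    x * (c + x ^' (p ℕ.* p ∸ 1))
      ≡⟨ distribˡ x c _ ⟩
    x * c + x ^' (p ℕ.* p)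
      ≡⟨ cong₂ _+_ (*-comm c x) (^'-assocʳ x p p) ⟨
    c * x + φ₁ (φ₁ x)
      ≡⟨ +-comm (c * x) _ ⟩
    φ₁ (φ₁ x) + c * x
      ∎

  G⇒root : ∀ {c} → G c → evalMonic (X^[p*p]+cX 1#) c ≡ 0#
  G⇒root {c} Gc = begin
    evalMonic (X^[p*p]+cX 1#) c    ≡⟨ evalMonic-X^[p*p]+cX 1# c ⟩
    φ₁ (φ₁ c) + 1# * c             ≡⟨ cong₂ _+_ (sym (x^'[p^2]≡φ₁[φ₁x] c)) (*-identityˡ c) ⟩
    c ^' (p ^ 2) + c               ≡⟨ Gc ⟩
    0#                             ∎

  x∈⟨x⟩ : ∀ x → ⟨ x ⟩ x
  x∈⟨x⟩ x = 1 , sym (+-identityʳ x)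

  ⟨⟩-⊆ : ∀ {c d} k → c ≡ ι k * d → ∀ x → ⟨ c ⟩ x → ⟨ d ⟩ x
  ⟨⟩-⊆ {c} {d} k c≡kd x (n , x≡nc) = n ℕ.* k , (begin
    x                  ≡⟨ x≡nc ⟩
    n ·' c             ≡⟨ ·'≡ι* n c ⟩
    ι n * c            ≡⟨ cong (ι n *_) c≡kd ⟩
    ι n * (ι k * d)    ≡⟨ *-assoc (ι n) (ι k) d ⟨
    ι n * ι k * d      ≡⟨ cong (_* d) (ι-homo-* n k) ⟨
    ι (n ℕ.* k) * d    ≡⟨ ·'≡ι* (n ℕ.* k) d ⟨
    (n ℕ.* k) ·' d     ∎)

  ⟨⟩-≐ : ∀ {c d} k → ι k ≢ 0# → c ≡ ι k * d → ⟨ c ⟩ ≐ ⟨ d ⟩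
  ⟨⟩-≐ {c} {d} k ιk≢0 c≡kd x = ⟨⟩-⊆ k c≡kd x , ⟨⟩-⊆ m d≡mc x
    where
    m = k ℕ.^ (p ∸ 2)
    d≡mc : d ≡ ι m * c
    d≡mc = begin
      d               ≡⟨ *-identityˡ d ⟨
      1# * d          ≡⟨ cong (_* d) (ι-inverse k ιk≢0) ⟨
      ι m * ι k * d   ≡⟨ *-assoc (ι m) (ι k) d ⟩
      ι m * (ι k * d) ≡⟨ cong (ι m *_) c≡kd ⟨
      ι m * c         ∎

  image-φ₁-⟨⟩ : ∀ c → image φ₁ ⟨ c ⟩ ≐ ⟨ φ₁ c ⟩
  image-φ₁-⟨⟩ c y =
    (λ { (x , (k , x≡kc) , φ₁x≡y) → k , trans (sym φ₁x≡y) (trans (cong φ₁ x≡kc) (^p-·' k c)) }) ,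
    (λ { (k , y≡kφ₁c) → k ·' c , (k , refl) , trans (^p-·' k c) (sym y≡kφ₁c) })

  image-φ₁-⟨φ₁⟩ : ∀ {c} → Gen c → image φ₁ ⟨ φ₁ c ⟩ ≐ ⟨ c ⟩
  image-φ₁-⟨φ₁⟩ {c} (Gc , _) = ≐-trans (image-φ₁-⟨⟩ (φ₁ c)) (⟨⟩-≐ (p ∸ 1) ι[p∸1]≢0 (begin
    φ₁ (φ₁ c)        ≡⟨ G⇒φ₁[φ₁x]≡-x Gc ⟩
    - c              ≡⟨ -1*x≈-x c ⟨
    - 1# * c         ≡⟨ cong (_* c) ι[p∸1]≡-1 ⟨
    ι (p ∸ 1) * c    ∎))
    where
    ι[p∸1]≢0 : ι (p ∸ 1) ≢ 0#
    ι[p∸1]≢0 = -1≢0 ∘′ trans (sym ι[p∸1]≡-1)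

  Gen-φ₁ : ∀ {c} → Gen c → Gen (φ₁ c)
  Gen-φ₁ {c} (Gc , c≢0) = φ₁[φ₁x]≡-x⇒G (trans (cong φ₁ (G⇒φ₁[φ₁x]≡-x Gc)) (^p-neg c)) , x^'n≢0 p c≢0

  φ₁∉⟨⟩ : ∀ {c} → Gen c → ¬ ⟨ c ⟩ (φ₁ c)
  φ₁∉⟨⟩ {c} (Gc , c≢0) (k , φ₁c≡kc) =
    no-𝔽ₚ-eigenvalue c≢0 (G⇒φ₁[φ₁x]≡-x Gc) (ι∈𝔽ₚ k) (trans φ₁c≡kc (·'≡ι* k c))

  not-stable : (c : Carrier) → Gen c → ¬ (∀ x → ⟨ c ⟩ x → ⟨ c ⟩ (φ₁ x))
  not-stable c Gen-c stable = φ₁∉⟨⟩ Gen-c (stable c (x∈⟨x⟩ c))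

  ⟨⟩≢⟨φ₁⟩ : ∀ {c} → Gen c → ¬ (⟨ c ⟩ ≐ ⟨ φ₁ c ⟩)
  ⟨⟩≢⟨φ₁⟩ {c} Gen-c ⟨c⟩≐⟨φ₁c⟩ = φ₁∉⟨⟩ Gen-c (proj₂ (⟨c⟩≐⟨φ₁c⟩ (φ₁ c)) (x∈⟨x⟩ (φ₁ c)))

  p*p<p^4 : p ℕ.* p < p ^ 4
  p*p<p^4 = subst (p ℕ.* p <_) (solve 1 (λ n → (n :* n) :* (n :* n) := n :^ 4) refl p)
              (ℕ.m<m*n (p ℕ.* p) (p ℕ.* p) (s≤s (s≤s z≤n)))
    where open +-*-Solver

  x₀ : Carrier
  x₀ = proj₁ (∃-non-root (X^[p*p]+cX (- 1#)) p*p<p^4)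

  a₀ : Carrier
  a₀ = φ₁ (φ₁ x₀) - x₀

  a₀≢0 : a₀ ≢ 0#
  a₀≢0 a₀≡0 = proj₂ (∃-non-root (X^[p*p]+cX (- 1#)) p*p<p^4) (begin
    evalMonic (X^[p*p]+cX (- 1#)) x₀   ≡⟨ evalMonic-X^[p*p]+cX (- 1#) x₀ ⟩
    φ₁ (φ₁ x₀) + - 1# * x₀             ≡⟨ cong (φ₁ (φ₁ x₀) +_) (-1*x≈-x x₀) ⟩
    a₀                                 ≡⟨ a₀≡0 ⟩
    0#                                 ∎)

  Ga₀ : G a₀
  Ga₀ = φ₁[φ₁x]≡-x⇒G (begin
    φ₁ (φ₁ (φ₁ (φ₁ x₀) - x₀))              ≡⟨ cong φ₁ (φ₁[x-y]≡φ₁x-φ₁y (φ₁ (φ₁ x₀)) x₀) ⟩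
    φ₁ (φ₁ (φ₁ (φ₁ x₀)) - φ₁ x₀)           ≡⟨ φ₁[x-y]≡φ₁x-φ₁y (φ₁ (φ₁ (φ₁ x₀))) (φ₁ x₀) ⟩
    φ₁ (φ₁ (φ₁ (φ₁ x₀))) - φ₁ (φ₁ x₀)      ≡⟨ cong (_- φ₁ (φ₁ x₀)) (φ₁⁴≡id x₀) ⟩
    x₀ - φ₁ (φ₁ x₀)                        ≡⟨ -[x-y]≡y-x (φ₁ (φ₁ x₀)) x₀ ⟨
    - a₀                                   ∎)

  [1+p]/2≡1+h : suc p / 2 ≡ suc h
  [1+p]/2≡1+h = trans (cong (_/ 2) 1+p≡[1+h]*2) (m*n/n≡m (suc h) 2)
    where
    1+p≡[1+h]*2 : suc p ≡ suc h ℕ.* 2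
    1+p≡[1+h]*2 = solve 1 (λ J → con 4 :+ con 4 :* J := (con 2 :+ con 2 :* J) :* con 2) refl J
      where open +-*-Solver

  module Basis (a : Carrier) (Ga : G a) (a≢0 : a ≢ 0#) where

    b : Carrier
    b = φ₁ a

    φ₁b≡-a : φ₁ b ≡ - a
    φ₁b≡-a = G⇒φ₁[φ₁x]≡-x Ga

    ⟪_,_⟫ : Carrier → Carrier → Carrier
    ⟪ μ , ν ⟫ = μ * a + ν * b

    φ₁-⟪⟫ : ∀ {μ ν} → 𝔽ₚ μ → 𝔽ₚ ν → φ₁ ⟪ μ , ν ⟫ ≡ ⟪ - ν , μ ⟫
    φ₁-⟪⟫ {μ} {ν} μ∈𝔽ₚ ν∈𝔽ₚ = begin
      φ₁ (μ * a + ν * b)        ≡⟨ ^p-+ (μ * a) (ν * b) ⟩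
      φ₁ (μ * a) + φ₁ (ν * b)   ≡⟨ cong₂ _+_ (^'-distrib-* μ a p) (^'-distrib-* ν b p) ⟩
      φ₁ μ * b + φ₁ ν * φ₁ b    ≡⟨ cong₂ (λ s t → s * b + t * φ₁ b) μ∈𝔽ₚ ν∈𝔽ₚ ⟩
      μ * b + ν * φ₁ b          ≡⟨ cong (λ t → μ * b + ν * t) φ₁b≡-a ⟩
      μ * b + ν * - a           ≡⟨ cong (μ * b +_) (trans (sym (-‿distribʳ-* ν a)) (-‿distribˡ-* ν a)) ⟩
      μ * b + - ν * a           ≡⟨ +-comm (μ * b) (- ν * a) ⟩
      - ν * a + μ * b           ∎

    -⟪⟫ : ∀ μ ν → ⟪ - μ , - ν ⟫ ≡ - ⟪ μ , ν ⟫
    -⟪⟫ μ ν =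
      trans (cong₂ _+_ (sym (-‿distribˡ-* μ a)) (sym (-‿distribˡ-* ν b))) (-x+-y≡-[x+y] (μ * a) (ν * b))

    G-⟪⟫ : ∀ {μ ν} → 𝔽ₚ μ → 𝔽ₚ ν → G ⟪ μ , ν ⟫
    G-⟪⟫ {μ} {ν} μ∈𝔽ₚ ν∈𝔽ₚ = φ₁[φ₁x]≡-x⇒G (begin
      φ₁ (φ₁ ⟪ μ , ν ⟫)   ≡⟨ cong φ₁ (φ₁-⟪⟫ μ∈𝔽ₚ ν∈𝔽ₚ) ⟩
      φ₁ ⟪ - ν , μ ⟫      ≡⟨ φ₁-⟪⟫ (𝔽ₚ-neg ν∈𝔽ₚ) μ∈𝔽ₚ ⟩
      ⟪ - μ , - ν ⟫       ≡⟨ -⟪⟫ μ ν ⟩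
      - ⟪ μ , ν ⟫         ∎)

    ⟪⟫-independent : ∀ {μ ν} → 𝔽ₚ μ → 𝔽ₚ ν → ⟪ μ , ν ⟫ ≡ 0# → μ ≡ 0# × ν ≡ 0#
    ⟪⟫-independent {μ} {ν} μ∈𝔽ₚ ν∈𝔽ₚ ⟪μ,ν⟫≡0 with ν ≟ 0#
    ... | yes ν≡0 = xy≡0⇒y≡0 a≢0 (trans (*-comm a μ) μa≡0) , ν≡0
      where
      μa≡0 : μ * a ≡ 0#
      μa≡0 = begin
        μ * a            ≡⟨ +-identityʳ (μ * a) ⟨
        μ * a + 0#       ≡⟨ cong (μ * a +_) (trans (cong (_* b) ν≡0) (zeroˡ b)) ⟨
        μ * a + ν * b    ≡⟨ ⟪μ,ν⟫≡0 ⟩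
        0#               ∎
    ... | no  ν≢0 =
      contradiction b≡-wμa (no-𝔽ₚ-eigenvalue a≢0 (G⇒φ₁[φ₁x]≡-x Ga) (𝔽ₚ-neg (𝔽ₚ-* w∈𝔽ₚ μ∈𝔽ₚ)))
      where
      w = proj₁ (inverse ν ν≢0)
      wν≡1 = trans (*-comm w ν) (proj₂ (inverse ν ν≢0))
      w∈𝔽ₚ = 𝔽ₚ-inverse ν∈𝔽ₚ ν≢0 wν≡1
      b≡-wμa : b ≡ - (w * μ) * a
      b≡-wμa = begin
        b                 ≡⟨ *-identityˡ b ⟨
        1# * b            ≡⟨ cong (_* b) wν≡1 ⟨
        w * ν * b         ≡⟨ *-assoc w ν b ⟩
        w * (ν * b)       ≡⟨ cong (w *_) (x+y≡0⇒x≡-y (ν * b) (μ * a) (trans (+-comm (ν * b) (μ * a)) ⟪μ,ν⟫≡0)) ⟩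
        w * - (μ * a)     ≡⟨ -‿distribʳ-* w (μ * a) ⟨
        - (w * (μ * a))   ≡⟨ cong -_ (*-assoc w μ a) ⟨
        - (w * μ * a)     ≡⟨ -‿distribˡ-* (w * μ) a ⟩
        - (w * μ) * a     ∎

    ⟪⟫-difference : ∀ μ ν μ′ ν′ → ⟪ μ , ν ⟫ - ⟪ μ′ , ν′ ⟫ ≡ ⟪ μ - μ′ , ν - ν′ ⟫
    ⟪⟫-difference μ ν μ′ ν′ = begin
      (μ * a + ν * b) - (μ′ * a + ν′ * b)
        ≡⟨ cong (μ * a + ν * b +_) (-x+-y≡-[x+y] (μ′ * a) (ν′ * b)) ⟨
      (μ * a + ν * b) + (- (μ′ * a) + - (ν′ * b))
        ≡⟨ solve 4 (λ A B A′ B′ → (A :+ B) :+ (A′ :+ B′) := (A :+ A′) :+ (B :+ B′)) refl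
             (μ * a) (ν * b) (- (μ′ * a)) (- (ν′ * b)) ⟩
      (μ * a - μ′ * a) + (ν * b - ν′ * b)
        ≡⟨ cong₂ _+_ ([y-z]x≈yx-zx a μ μ′) ([y-z]x≈yx-zx b ν ν′) ⟨
      (μ - μ′) * a + (ν - ν′) * b
        ∎
      where open RingSolver

    ⟪ι⟫-injective : ∀ {x y x′ y′} → x < p → y < p → x′ < p → y′ < p →
                    ⟪ ι x , ι y ⟫ ≡ ⟪ ι x′ , ι y′ ⟫ → x ≡ x′ × y ≡ y′
    ⟪ι⟫-injective {x} {y} {x′} {y′} x<p y<p x′<p y′<p eq =
      ι-injective x<p x′<p (x-y≡0⇒x≡y (ι x) (ι x′) ιx-ιx′≡0) ,
      ι-injective y<p y′<p (x-y≡0⇒x≡y (ι y) (ι y′) ιy-ιy′≡0)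
      where
      differences≡0 = ⟪⟫-independent (𝔽ₚ-+ (ι∈𝔽ₚ x) (𝔽ₚ-neg (ι∈𝔽ₚ x′))) (𝔽ₚ-+ (ι∈𝔽ₚ y) (𝔽ₚ-neg (ι∈𝔽ₚ y′)))
                        (trans (sym (⟪⟫-difference (ι x) (ι y) (ι x′) (ι y′))) (x≡y⇒x-y≡0 eq))
      ιx-ιx′≡0 = proj₁ differences≡0
      ιy-ιy′≡0 = proj₂ differences≡0

    ⟪ι⟫ᶠ : Fin p × Fin p → Carrier
    ⟪ι⟫ᶠ (x , y) = ⟪ ι (toℕ x) , ι (toℕ y) ⟫

    ⟪ι⟫ᶠ-injective : Injective _≡_ _≡_ ⟪ι⟫ᶠ
    ⟪ι⟫ᶠ-injective {x , y} {x′ , y′} eq =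
      let x≡x′ , y≡y′ = ⟪ι⟫-injective (Fin.toℕ<n x) (Fin.toℕ<n y) (Fin.toℕ<n x′) (Fin.toℕ<n y′) eq
      in cong₂ _,_ (Fin.toℕ-injective x≡x′) (Fin.toℕ-injective y≡y′)

    G-enumeration : Fin (p ℕ.* p) → Carrier
    G-enumeration = ⟪ι⟫ᶠ ∘′ Fin.remQuot {p} p

    G-enumeration-injective : Injective _≡_ _≡_ G-enumeration
    G-enumeration-injective {i} {j} eq = begin
      i                                          ≡⟨ Fin.combine-remQuot {p} p i ⟨
      uncurry Fin.combine (Fin.remQuot {p} p i)  ≡⟨ cong (uncurry Fin.combine) (⟪ι⟫ᶠ-injective {xy} {xy′} eq) ⟩
      uncurry Fin.combine (Fin.remQuot {p} p j)  ≡⟨ Fin.combine-remQuot {p} p j ⟩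
      j                                          ∎
      where
      xy = Fin.remQuot {p} p i
      xy′ = Fin.remQuot {p} p j

    G-⟪ι⟫ᶠ : ∀ xy → G (⟪ι⟫ᶠ xy)
    G-⟪ι⟫ᶠ (x , y) = G-⟪⟫ (ι∈𝔽ₚ (toℕ x)) (ι∈𝔽ₚ (toℕ y))

    G⇒⟪ι⟫ᶠ : ∀ {c} → G c → ∃ λ xy → c ≡ ⟪ι⟫ᶠ xy
    G⇒⟪ι⟫ᶠ Gc =
      let i , c≡ = distinct-roots-exhaustive _≟_ (X^[p*p]+cX 1#) G-enumeration G-enumeration-injective
                     (λ i → G⇒root (G-⟪ι⟫ᶠ (Fin.remQuot {p} p i))) (G⇒root Gc)
      in Fin.remQuot {p} p i , c≡

    u v : ℕ → Carrier
    u j = ⟪ 1# , ι j * ι j ⟫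
    v j = φ₁ (u j)

    1∈𝔽ₚ : 𝔽ₚ 1#
    1∈𝔽ₚ = 1^'n≡1 p

    j²∈𝔽ₚ : ∀ j → 𝔽ₚ (ι j * ι j)
    j²∈𝔽ₚ j = 𝔽ₚ-* (ι∈𝔽ₚ j) (ι∈𝔽ₚ j)

    Gen-u : ∀ j → Gen (u j)
    Gen-u j = G-⟪⟫ 1∈𝔽ₚ (j²∈𝔽ₚ j) , 1≢0 ∘′ proj₁ ∘′ ⟪⟫-independent 1∈𝔽ₚ (j²∈𝔽ₚ j)

    v≡⟪-j²,1⟫ : ∀ j → v j ≡ ⟪ - (ι j * ι j) , 1# ⟫
    v≡⟪-j²,1⟫ j = φ₁-⟪⟫ 1∈𝔽ₚ (j²∈𝔽ₚ j)

    v0≡b : v 0 ≡ b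
    v0≡b = begin
      v 0                    ≡⟨ v≡⟪-j²,1⟫ 0 ⟩
      ⟪ - (0# * 0#) , 1# ⟫   ≡⟨ cong ⟪_, 1# ⟫ (trans (cong -_ (zeroˡ 0#)) -0#≡0#) ⟩
      0# * a + 1# * b        ≡⟨ cong₂ _+_ (zeroˡ a) (*-identityˡ b) ⟩
      0# + b                 ≡⟨ +-identityˡ b ⟩
      b                      ∎

    *-⟪⟫ : ∀ κ μ ν → κ * ⟪ μ , ν ⟫ ≡ ⟪ κ * μ , κ * ν ⟫
    *-⟪⟫ κ μ ν =
      solve 5 (λ κ μ ν a b → κ :* (μ :* a :+ ν :* b) := κ :* μ :* a :+ κ :* ν :* b) refl κ μ ν a b
      where open RingSolver

    Covered : Carrier → Set
    Covered c = ∃ λ j → j ≤ h × (⟨ c ⟩ ≐ ⟨ u j ⟩ ⊎ ⟨ c ⟩ ≐ ⟨ v j ⟩)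

    -- Either ι n = j² and ⟪ 1 , ι n ⟫ = u j, or ι n j² = -1 and ⟪ 1 , ι n ⟫ = ι n · v j.
    ⟪1,ιn⟫-covered : ∀ {c} x n → ι x ≢ 0# → c ≡ ι x * ⟪ 1# , ι n ⟫ → Covered c
    ⟪1,ιn⟫-covered {c} x n ιx≢0 c≡ιx⟪1,ιn⟫ with ι-square-or-antisquare n
    ... | j , j≤h , inj₁ ιn≡j² =
      j , j≤h , inj₁ (⟨⟩-≐ x ιx≢0 (trans c≡ιx⟪1,ιn⟫ (cong (λ ν → ι x * ⟪ 1# , ν ⟫) ιn≡j²)))
    ... | j , j≤h , inj₂ ιnj²≡-1 = j , j≤h , inj₂ (⟨⟩-≐ (x ℕ.* n) ι[xn]≢0 (begin
      c                          ≡⟨ c≡ιx⟪1,ιn⟫ ⟩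
      ι x * ⟪ 1# , ι n ⟫         ≡⟨ cong (ι x *_) ⟪1,ιn⟫≡ιn*vj ⟩
      ι x * (ι n * v j)          ≡⟨ *-assoc (ι x) (ι n) (v j) ⟨
      ι x * ι n * v j            ≡⟨ cong (_* v j) (ι-homo-* x n) ⟨
      ι (x ℕ.* n) * v j          ∎))
      where
      ιn≢0 : ι n ≢ 0#
      ιn≢0 ιn≡0 = -1≢0 (trans (sym ιnj²≡-1) (trans (cong (_* (ι j * ι j)) ιn≡0) (zeroˡ _)))
      ι[xn]≢0 : ι (x ℕ.* n) ≢ 0#
      ι[xn]≢0 = x*y≢0 ιx≢0 ιn≢0 ∘′ trans (sym (ι-homo-* x n))
      ⟪1,ιn⟫≡ιn*vj : ⟪ 1# , ι n ⟫ ≡ ι n * v j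
      ⟪1,ιn⟫≡ιn*vj = sym (begin
        ι n * v j                                 ≡⟨ cong (ι n *_) (v≡⟪-j²,1⟫ j) ⟩
        ι n * ⟪ - (ι j * ι j) , 1# ⟫              ≡⟨ *-⟪⟫ (ι n) _ 1# ⟩
        ⟪ ι n * - (ι j * ι j) , ι n * 1# ⟫        ≡⟨ cong₂ ⟪_,_⟫ (-‿distribʳ-* (ι n) _) (sym (*-identityʳ (ι n))) ⟨
        ⟪ - (ι n * (ι j * ι j)) , ι n ⟫           ≡⟨ cong ⟪_, ι n ⟫ (trans (cong -_ ιnj²≡-1) (-‿involutive 1#)) ⟩
        ⟪ 1# , ι n ⟫                              ∎)

    ⟪ιx,ιy⟫-covered : ∀ {c} x y → c ≢ 0# → c ≡ ⟪ ι x , ι y ⟫ → Covered c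
    ⟪ιx,ιy⟫-covered {c} x y c≢0 c≡⟪ιx,ιy⟫ with ι x ≟ 0#
    ... | yes ιx≡0 = 0 , z≤n , inj₂ (⟨⟩-≐ y ιy≢0 c≡ιy*v0)
      where
      c≡ιy*v0 : c ≡ ι y * v 0
      c≡ιy*v0 = begin
        c                    ≡⟨ c≡⟪ιx,ιy⟫ ⟩
        ι x * a + ι y * b    ≡⟨ cong (λ μ → μ * a + ι y * b) ιx≡0 ⟩
        0# * a + ι y * b     ≡⟨ trans (cong (_+ ι y * b) (zeroˡ a)) (+-identityˡ _) ⟩
        ι y * b              ≡⟨ cong (ι y *_) v0≡b ⟨
        ι y * v 0            ∎
      ιy≢0 : ι y ≢ 0#
      ιy≢0 ιy≡0 = c≢0 (trans c≡ιy*v0 (trans (cong (_* v 0) ιy≡0) (zeroˡ (v 0))))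
    ... | no  ιx≢0 = ⟪1,ιn⟫-covered x n ιx≢0 (begin
      c                              ≡⟨ c≡⟪ιx,ιy⟫ ⟩
      ⟪ ι x , ι y ⟫                  ≡⟨ cong₂ ⟪_,_⟫ (*-identityʳ (ι x)) ιx*ιn≡ιy ⟨
      ⟪ ι x * 1# , ι x * ι n ⟫       ≡⟨ *-⟪⟫ (ι x) 1# (ι n) ⟨
      ι x * ⟪ 1# , ι n ⟫             ∎)
      where
      m = x ℕ.^ (p ∸ 2)
      n = m ℕ.* y
      ιx*ιn≡ιy : ι x * ι n ≡ ι y
      ιx*ιn≡ιy = begin
        ι x * ι n              ≡⟨ cong (ι x *_) (ι-homo-* m y) ⟩
        ι x * (ι m * ι y)      ≡⟨ solve 3 (λ X M Y → X :* (M :* Y) := (M :* X) :* Y) refl (ι x) (ι m) (ι y) ⟩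
        ι m * ι x * ι y        ≡⟨ cong (_* ι y) (ι-inverse x ιx≢0) ⟩
        1# * ι y               ≡⟨ *-identityˡ (ι y) ⟩
        ι y                    ∎
        where open RingSolver

    cover : ∀ {c} → Gen c → Covered c
    cover (Gc , c≢0) =
      let (x , y) , c≡⟪ιx,ιy⟫ = G⇒⟪ι⟫ᶠ Gc in ⟪ιx,ιy⟫-covered (toℕ x) (toℕ y) c≢0 c≡⟪ιx,ιy⟫

    swapped-pair : ∀ j → Gen (u j) × Gen (v j) × ¬ (⟨ u j ⟩ ≐ ⟨ v j ⟩)
                         × (image φ₁ ⟨ u j ⟩ ≐ ⟨ v j ⟩) × (image φ₁ ⟨ v j ⟩ ≐ ⟨ u j ⟩)
    swapped-pair j = Gen-u j , Gen-φ₁ (Gen-u j) , ⟨⟩≢⟨φ₁⟩ (Gen-u j) , image-φ₁-⟨⟩ (u j) , image-φ₁-⟨φ₁⟩ (Gen-u j)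

    index : ∀ {c} → Covered c → ∃ λ (k : Fin (suc p / 2)) → (⟨ c ⟩ ≐ ⟨ u (toℕ k) ⟩) ⊎ (⟨ c ⟩ ≐ ⟨ v (toℕ k) ⟩)
    index {c} (j , j≤h , covered) = Fin.fromℕ< j<[1+p]/2 ,
      subst (λ i → (⟨ c ⟩ ≐ ⟨ u i ⟩) ⊎ (⟨ c ⟩ ≐ ⟨ v i ⟩)) (sym (Fin.toℕ-fromℕ< j<[1+p]/2)) covered
      where
      j<[1+p]/2 : j < suc p / 2
      j<[1+p]/2 = subst (j <_) (sym [1+p]/2≡1+h) (s≤s j≤h)

    swapped-pairs :
      Σ (Fin ((suc p) / 2) → Carrier) λ u → Σ (Fin ((suc p) / 2) → Carrier) λ v →
        ((k : Fin ((suc p) / 2)) →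
          Gen (u k) × Gen (v k) × ¬ (⟨ u k ⟩ ≐ ⟨ v k ⟩)
          × (image φ₁ ⟨ u k ⟩ ≐ ⟨ v k ⟩) × (image φ₁ ⟨ v k ⟩ ≐ ⟨ u k ⟩))
        × ((c : Carrier) → Gen c → ∃ λ k → (⟨ c ⟩ ≐ ⟨ u k ⟩) ⊎ (⟨ c ⟩ ≐ ⟨ v k ⟩))
    swapped-pairs = u ∘′ toℕ , v ∘′ toℕ , (λ k → swapped-pair (toℕ k)) , (λ c Gen-c → index (cover Gen-c))

  open Basis a₀ Ga₀ a₀≢0 public using (swapped-pairs)

theorem4p6 : (p : ℕ) → Prime p → p % 2 ≡ 1 → ¬ (4 ∣ (p ∸ 1)) →
    (K : FiniteField (p ^ 4)) →
    let open FieldDefs K p in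
      ((a : Carrier) → Gen a → ¬ (∀ x → ⟨ a ⟩ x → ⟨ a ⟩ (φ₁ x)))
      ×
      (Σ (Fin ((suc p) / 2) → Carrier) λ u → Σ (Fin ((suc p) / 2) → Carrier) λ v →
        ((k : Fin ((suc p) / 2)) →
          Gen (u k) × Gen (v k) × ¬ (⟨ u k ⟩ ≐ ⟨ v k ⟩)
          × (image φ₁ ⟨ u k ⟩ ≐ ⟨ v k ⟩) × (image φ₁ ⟨ v k ⟩ ≐ ⟨ u k ⟩))
        × ((c : Carrier) → Gen c → ∃ λ k → (⟨ c ⟩ ≐ ⟨ u k ⟩) ⊎ (⟨ c ⟩ ≐ ⟨ v k ⟩)))
theorem4p6 p p-prime odd 4∤p∸1 K with odd∧4∤p∸1⇒p≡3+4J p odd 4∤p∸1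
... | J , refl = not-stable , swapped-pairs
  where open Theorem J p-prime K
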